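{- Let $G$ be a directed graph on vertices $\{1,\dots,N\}$ with weights $w_{ij}\in\mathbb{R}\cup\{\infty\}$, where $w_{ii}=0$ and $w_{ij}=\infty$ if and only if there is no edge from $i$ to $j$ ($i\neq j$). Define matrices $D^k=(d^k_{ij})$ and sets $in^k_v, out^k_v\subseteq\{1,\dots,N\}$ for $k=0,1,\dots,N$ by: - $d^0_{ij}=w_{ij}$, $in^0_j=\{i: i\neq j,\ w_{ij}\neq\infty\}$, $out^0_i=\{j: j\neq i,\ w_{ij}\neq\infty\}$; - for $k\ge 1$: $d^k_{ij}=\min(d^{k-1}_{ij},\ d^{k-1}_{ik}+d^{k-1}_{kj})$ if $i\in in^{k-1}_k$ and $j\in out^{k-1}_k$, and $d^k_{ij}=d^{k-1}_{ij}$ otherwise; - for $k\ge1$: $in^k_j=in^{k-1}_j\cup\{i: d^{k-1}_{ij}=\infty,\ d^k_{ij}\neq\infty\}$ and $out^k_i=out^{k-1}_i\cup\{j: d^{k-1}_{ij}=\infty,\ d^k_{ij}\neq\infty\}$. In this recurrence, for each $k\ge1$ a relaxation attempt on the pair $(i,j)$ (i.e., evaluation of the comparison of $d^{k-1}_{ik}+d^{k-1}_{kj}$ with $d^{k-1}_{ij}$) is made exactly when $i\in in^{k-1}_k$ and $j\in out^{k-1}_k$. Then no useless relaxation attempt occurs: for every $k\ge1$ and every such pair $(i,j)$, both $d^{k-1}_{ik}$ and $d^{k-1}_{kj}$ are finite (not $\infty$).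
   Context: A relaxation attempt for the triple $(i,k,j)$ is the operation "if $d_{ik}+d_{kj}<d_{ij}$ then $d_{ij}\leftarrow d_{ik}+d_{kj}$". It is called useless if $d_{ik}=\infty$ or $d_{kj}=\infty$. The sets $in^\beta_\alpha$ (resp. $out^\beta_\alpha$) are intended as the lists of vertices at the other end of the incoming (resp. outgoing) finite entries of vertex $\alpha$ in the matrix $D^\beta$. -}

module Defs where

open import Data.Nat using (ℕ; zero; suc; _<?_)
open import Data.Fin using (Fin; fromℕ<; _≟_)
open import Data.Bool using (Bool; true; false; _∧_; _∨_; not; if_then_else_)
open import Relation.Nullary using (yes; no)
open import Relation.Nullary.Decidable using (⌊_⌋)
open import Relation.Binary using (Decidable)

-- Weights are drawn from an arbitrary type R with a zero, an addition and a
-- decidable comparison ≤ (the paper uses R = ℝ), extended by ∞.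
module FW (R : Set) (0# : R) (_+_ : R → R → R)
          (_≤_ : R → R → Set) (_≤?_ : Decidable _≤_) where

  data R∞ : Set where
    fin : R → R∞
    ∞   : R∞

  isInf : R∞ → Bool
  isInf (fin _) = false
  isInf ∞       = true

  _+∞_ : R∞ → R∞ → R∞
  fin a +∞ fin b = fin (a + b)
  fin _ +∞ ∞     = ∞
  ∞     +∞ _     = ∞

  min∞ : R∞ → R∞ → R∞
  min∞ ∞ y = y
  min∞ (fin a) ∞ = fin a
  min∞ (fin a) (fin b) = if ⌊ a ≤? b ⌋ then fin a else fin b

  module _ (N : ℕ) where

    -- State after stage k: the matrix D^k and the sets in^k, out^k.
    -- inS v u  = true  iff  u ∈ in_v ;  outS v u = true iff u ∈ out_v.
    record State : Set where
      field
        d    : Fin N → Fin N → R∞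
        inS  : Fin N → Fin N → Bool
        outS : Fin N → Fin N → Bool
    open State public

    initial : (Fin N → Fin N → R∞) → State
    initial w = record
      { d    = w
      ; inS  = λ j i → not ⌊ i ≟ j ⌋ ∧ not (isInf (w i j))
      ; outS = λ i j → not ⌊ j ≟ i ⌋ ∧ not (isInf (w i j))
      }

    attempted : State → Fin N → Fin N → Fin N → Bool
    attempted s k i j = inS s k i ∧ outS s k j

    step : Fin N → State → State
    step k s = record
      { d    = d'
      ; inS  = λ j i → inS s j i ∨ (isInf (d s i j) ∧ not (isInf (d' i j)))
      ; outS = λ i j → outS s i j ∨ (isInf (d s i j) ∧ not (isInf (d' i j)))
      }
      where
      d' : Fin N → Fin N → R∞
      d' i j = if attempted s k i j
                 then min∞ (d s i j) (d s i k +∞ d s k j)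
                 else d s i j

    -- stage m (m = 0..N); stage m+1 processes vertex number m (0-based),
    -- i.e. the paper's vertex m+1.
    stage : (Fin N → Fin N → R∞) → ℕ → State
    stage w zero = initial w
    stage w (suc m) with m <? N
    ... | yes p = step (fromℕ< p) (stage w m)
    ... | no _  = stage w m

-- Every stage keeps the invariant that a vertex listed in in_v (resp. out_v)
-- has a finite entry towards (resp. from) v. Initially this is how the lists
-- are defined; a stage never makes a finite entry infinite, since the minimum
-- with a finite value is finite, and it adds a vertex to a list only when the
-- corresponding entry has just become finite. An attempt on (i, j) through k
-- requires i ∈ in_k and j ∈ out_k, so d_ik and d_kj are finite.
module Submission where

open import Defs
open import Data.Nat using (ℕ; zero; suc; _<?_)
open import Data.Fin using (Fin; toℕ; fromℕ<)
open import Data.Bool using (true; false; _∧_; _∨_; not; if_then_else_)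
open import Data.Bool.Properties using (∧-conicalˡ; ∧-conicalʳ)
open import Data.Product using (_×_; _,_)
open import Relation.Binary using (Decidable)
open import Relation.Binary.PropositionalEquality using (_≡_; _≢_; refl)
open import Relation.Nullary using (yes; no)
open import Relation.Nullary.Decidable using (⌊_⌋)

module _ (R : Set) (0# : R) (_+_ : R → R → R) (_≤_ : R → R → Set) (_≤?_ : Decidable _≤_) where
  open FW R 0# _+_ _≤_ _≤?_

  Finite : R∞ → Set
  Finite x = isInf x ≡ false

  Finite⇒≢∞ : ∀ {x} → Finite x → x ≢ ∞
  Finite⇒≢∞ {fin _} _ ()

  not-isInf⇒Finite : ∀ x → not (isInf x) ≡ true → Finite x
  not-isInf⇒Finite (fin _) _ = refl

  min∞-preserves-Finite : ∀ x y → Finite x → Finite (min∞ x y)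
  min∞-preserves-Finite (fin a) ∞       _ = refl
  min∞-preserves-Finite (fin a) (fin b) _ with ⌊ a ≤? b ⌋
  ... | true  = refl
  ... | false = refl

  relax-preserves-Finite : ∀ b x y → Finite x → Finite (if b then min∞ x y else x)
  relax-preserves-Finite true  x y fx = min∞-preserves-Finite x y fx
  relax-preserves-Finite false x y fx = fx

  Finite-after-update : ∀ old x y → old ∨ (isInf x ∧ not (isInf y)) ≡ true
                      → (old ≡ true → Finite y) → Finite y
  Finite-after-update true  x y _ keep = keep refl
  Finite-after-update false x y e _    =
    not-isInf⇒Finite y (∧-conicalʳ (isInf x) (not (isInf y)) e)

  record ListsFinite {N : ℕ} (s : State N) : Set where
    field
      in-Finite  : ∀ v u → inS s v u ≡ true → Finite (d s u v)
      out-Finite : ∀ v u → outS s v u ≡ true → Finite (d s v u)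
  open ListsFinite

  initial-ListsFinite : ∀ {N} w → ListsFinite (initial N w)
  initial-ListsFinite w = record
    { in-Finite  = λ v u e → not-isInf⇒Finite (w u v) (∧-conicalʳ _ _ e)
    ; out-Finite = λ v u e → not-isInf⇒Finite (w v u) (∧-conicalʳ _ _ e)
    }

  step-ListsFinite : ∀ {N} k (s : State N) → ListsFinite s → ListsFinite (step N k s)
  step-ListsFinite {N} k s inv = record
    { in-Finite  = λ v u e → Finite-after-update _ (d s u v) _ e
        λ old → relax-preserves-Finite (attempted N s k u v) (d s u v) _ (in-Finite inv v u old)
    ; out-Finite = λ v u e → Finite-after-update _ (d s v u) _ e
        λ old → relax-preserves-Finite (attempted N s k v u) (d s v u) _ (out-Finite inv v u old)
    }

  stage-ListsFinite : ∀ {N} w m → ListsFinite (stage N w m)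
  stage-ListsFinite w zero = initial-ListsFinite w
  stage-ListsFinite {N} w (suc m) with m <? N
  ... | yes m<N = step-ListsFinite (fromℕ< m<N) (stage N w m) (stage-ListsFinite w m)
  ... | no  _   = stage-ListsFinite w m

  attempt-operands-finite : ∀ {N} (s : State N) → ListsFinite s → ∀ k i j
                          → attempted N s k i j ≡ true → d s i k ≢ ∞ × d s k j ≢ ∞
  attempt-operands-finite s inv k i j e =
    Finite⇒≢∞ (in-Finite inv k i (∧-conicalˡ _ _ e)) ,
    Finite⇒≢∞ (out-Finite inv k j (∧-conicalʳ _ _ e))

theorem1 : (R : Set) (0# : R) (_+_ : R → R → R) (_≤_ : R → R → Set) (_≤?_ : Decidable _≤_)
    → let open FW R 0# _+_ _≤_ _≤?_ in
    (N : ℕ) (w : Fin N → Fin N → R∞)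
    → (∀ i → w i i ≡ fin 0#)
    → (k i j : Fin N)
    → attempted N (stage N w (toℕ k)) k i j ≡ true
    → (d (stage N w (toℕ k)) i k ≢ ∞) × (d (stage N w (toℕ k)) k j ≢ ∞)
theorem1 R 0# _+_ _≤_ _≤?_ N w _ k =
  attempt-operands-finite R 0# _+_ _≤_ _≤?_ _ (stage-ListsFinite R 0# _+_ _≤_ _≤?_ w (toℕ k)) k
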